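{- Let $r$ be a positive integer or $r=\infty$. Let $(A,B)$ be a partition of the vertex set of a graph $G$ such that the relation $\equiv_{(A,B)}$ has $k$ equivalence classes. If $G[A]$ and $G[B]$ each have a weak $r$-guidance system of maximum outdegree at most $c$, then $G$ has a weak $r$-guidance system of maximum outdegree at most $c+k$.
   Context: All graphs are finite, simple and undirected. For $u,v\in V(G)$, $u\equiv_{(A,B)}v$ holds if either $u,v\in A$ and $u,v$ have the same neighbors in $B$, or $u,v\in B$ and $u,v$ have the same neighbors in $A$. A partial orientation of $G$ is a directed graph $\vec{H}$ on $V(G)$ whose arcs $(u,v)$ satisfy $uv\in E(G)$; $B_{\vec{H}}(v,a)$ is the set of vertices reachable from $v$ by directed paths of length at most $a$. For a positive integer $r$, a weak $r$-guidance system is a partial orientation $\vec{H}$ such that for any distinct $u,v$ at distance $\ell\le r$ there are non-negative integers $a,b$ with $a+b=\ell-1$ and an edge of $G$ between $B_{\vec{H}}(u,a)$ and $B_{\vec{H}}(v,b)$. A weak $\infty$-guidance system is a partial orientation that is a weak $r$-guidance system for every positive integer $r$. -}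

module Defs where

open import Data.Nat using (ℕ; zero; suc; _+_; _≤_)
open import Data.Fin using (Fin)
open import Data.Bool using (Bool; true; false)
open import Data.List using (List; length)
open import Data.List.Membership.Propositional using (_∈_)
open import Data.Product using (Σ; ∃; _×_; _,_; proj₁)
open import Data.Sum using (_⊎_)
open import Relation.Nullary using (¬_; Dec)
open import Relation.Binary.PropositionalEquality using (_≡_; _≢_)

record Graph (V : Set) : Set₁ where
  field
    E      : V → V → Set
    E?     : ∀ u v → Dec (E u v)
    sym    : ∀ {u v} → E u v → E v u
    irrefl : ∀ {v} → ¬ E v v
open Graph public

induced : ∀ {V : Set} → Graph V → (P : V → Set) → Graph (Σ V P)
induced G P = record
  { E      = λ u v → E G (proj₁ u) (proj₁ v)
  ; E?     = λ u v → E? G (proj₁ u) (proj₁ v)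
  ; sym    = sym G
  ; irrefl = irrefl G
  }

data Walk {V : Set} (G : Graph V) : V → V → ℕ → Set where
  nil  : ∀ {v} → Walk G v v 0
  cons : ∀ {u x v ℓ} → E G u x → Walk G x v ℓ → Walk G u v (suc ℓ)

Dist : ∀ {V : Set} → Graph V → V → V → ℕ → Set
Dist G u v ℓ = Walk G u v ℓ × (∀ m → Walk G u v m → ℓ ≤ m)

record PartialOrientation {V : Set} (G : Graph V) : Set₁ where
  field
    arc    : V → V → Set
    arc⊆E  : ∀ {u v} → arc u v → E G u v
open PartialOrientation public

-- Reach H v a w : w ∈ B_H(v,a), i.e. w reachable from v by a directed
-- path (equivalently walk) of length at most a.
data Reach {V : Set} {G : Graph V} (H : PartialOrientation G) : V → ℕ → V → Set where
  here : ∀ {v a} → Reach H v a v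
  step : ∀ {v x w a} → arc H v x → Reach H x a w → Reach H v (suc a) w

MaxOutDeg≤ : ∀ {V : Set} {G : Graph V} → PartialOrientation G → ℕ → Set
MaxOutDeg≤ {V} H c = ∀ v → Σ (List V) λ L → length L ≤ c × (∀ w → arc H v w → w ∈ L)

WeakGuidanceℕ : ∀ {V : Set} (G : Graph V) → ℕ → PartialOrientation G → Set
WeakGuidanceℕ {V} G r H =
  ∀ u v → u ≢ v → ∀ ℓ → ℓ ≤ r → Dist G u v ℓ →
  Σ ℕ λ a → Σ ℕ λ b → suc (a + b) ≡ ℓ ×
  Σ V λ x → Σ V λ y → Reach H u a x × Reach H v b y × E G x y

data Radius : Set where
  fin : ℕ → Radius
  ∞   : Radius

PositiveRadius : Radius → Set
PositiveRadius (fin r) = 1 ≤ r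
PositiveRadius ∞       = 1 ≤ 1

WeakGuidance : ∀ {V : Set} (G : Graph V) → Radius → PartialOrientation G → Set
WeakGuidance G (fin r) H = WeakGuidanceℕ G r H
WeakGuidance G ∞       H = ∀ r → 1 ≤ r → WeakGuidanceℕ G r H

-- Partition (A,B) of V encoded by A : V → Bool (A = true-part, B = false-part).
-- u ≡_(A,B) v
EquivAB : ∀ {V : Set} → Graph V → (V → Bool) → V → V → Set
EquivAB {V} G A u v =
    (A u ≡ true  × A v ≡ true  × (∀ w → A w ≡ false → (E G u w → E G v w) × (E G v w → E G u w)))
  ⊎ (A u ≡ false × A v ≡ false × (∀ w → A w ≡ true  → (E G u w → E G v w) × (E G v w → E G u w)))

HasClasses : ∀ {V : Set} → (V → V → Set) → ℕ → Set
HasClasses {V} R k =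
  Σ (V → Fin k) λ f → (∀ i → Σ V λ v → f v ≡ i) ×
    (∀ u v → (R u v → f u ≡ f v) × (f u ≡ f v → R u v))

{-# OPTIONS --safe #-}
module Submission where

-- Keep the arcs of both sides and add, for every vertex u and every
-- ≡_(A,B)-class C, one arc from u to a neighbour one step closer to C: at most
-- k extra out-arcs.  Following these arcs, a vertex at distance m from C
-- reaches a vertex of C in m steps.  A shortest u–v walk either stays on one
-- side, where it is still shortest and that side's system applies, or uses an
-- edge xy between A and B.  Then u reaches some x′ ≡ x and v some y′ ≡ y in
-- the required numbers of steps, and x′y′ is an edge since x, y lie on
-- opposite sides and ≡_(A,B) preserves neighbourhoods across the partition.

open import Defs hiding (sym)
open import Data.Nat using (ℕ; zero; suc; _+_; _≤_; _<_; _≤′_; ≤′-refl; ≤′-step; z≤n; s≤s)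
open import Data.Nat.Properties using (≤-refl; ≤-trans; ≤⇒≤′; 1+n≰n; ≤-pred; m<n⇒m<1+n; +-mono-≤; ≰⇒>; <⇒≤; _≤?_)
open import Data.Fin using (Fin)
open import Data.Fin.Properties using (any?; _≟_)
open import Data.Fin.Subset using (Subset; ∣_∣; _⊂_) renaming (_∈_ to _∈ₛ_)
open import Data.Fin.Subset.Properties using (∣p∣≤n; p⊂q⇒∣p∣<∣q∣)
open import Data.Bool using (Bool; true; false) renaming (_≟_ to _≟ᴮ_)
open import Data.Vec using () renaming (tabulate to tabulateᵥ)
open import Data.Vec.Properties using (lookup∘tabulate; lookup⇒[]=; []=⇒lookup)
open import Data.List using (List; length; map; _++_; tabulate)
open import Data.List.Properties using (length-map; length-++; length-tabulate)
open import Data.List.Membership.Propositional using (_∈_)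
open import Data.List.Membership.Propositional.Properties using (∈-map⁺; ∈-++⁺ˡ; ∈-++⁺ʳ; ∈-tabulate⁺)
open import Data.Product using (Σ; ∃; _×_; _,_; proj₁; proj₂)
import Data.Product as Product
open import Data.Sum using (_⊎_; inj₁; inj₂)
open import Level using (0ℓ)
open import Function using (_∘_; id)
open import Relation.Nullary using (yes; no; does; contradiction)
open import Relation.Nullary.Decidable using (dec-true; decidable-stable; _⊎-dec_; _×-dec_; ¬?)
open import Relation.Unary using (Pred; Decidable; _⊆_)
open import Relation.Binary.PropositionalEquality using (_≡_; _≢_; refl; sym; trans; cong)

Reach-suc : ∀ {V} {G : Graph V} {H : PartialOrientation G} {u a y} →
            Reach H u a y → Reach H u (suc a) y
Reach-suc here       = here
Reach-suc (step x r) = step x (Reach-suc r)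

Reach-map : ∀ {V W} {G : Graph V} {G′ : Graph W}
            {H : PartialOrientation G} {H′ : PartialOrientation G′} (g : V → W) →
            (∀ {x y} → arc H x y → arc H′ (g x) (g y)) →
            ∀ {u a y} → Reach H u a y → Reach H′ (g u) a (g y)
Reach-map g arc↦ here       = here
Reach-map g arc↦ (step x r) = step (arc↦ x) (Reach-map g arc↦ r)

Walk-map : ∀ {V W} {G : Graph V} {G′ : Graph W} (g : V → W) →
           (∀ {x y} → E G x y → E G′ (g x) (g y)) →
           ∀ {u v ℓ} → Walk G u v ℓ → Walk G′ (g u) (g v) ℓ
Walk-map g edge↦ nil        = nil
Walk-map g edge↦ (cons e W) = cons (edge↦ e) (Walk-map g edge↦ W)

Walk-snoc : ∀ {V} {G : Graph V} {u v w ℓ} → Walk G u v ℓ → E G v w → Walk G u w (suc ℓ)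
Walk-snoc nil         e = cons e nil
Walk-snoc (cons e′ W) e = cons e′ (Walk-snoc W e)

Walk-reverse : ∀ {V} {G : Graph V} {u v ℓ} → Walk G u v ℓ → Walk G v u ℓ
Walk-reverse         nil        = nil
Walk-reverse {G = G} (cons e W) = Walk-snoc (Walk-reverse W) (Graph.sym G e)

least : ∀ {ℓ} {P : Pred ℕ ℓ} → Decidable P → ℕ → ℕ
least P? zero = zero
least P? (suc b) with P? zero
... | yes _ = zero
... | no  _ = suc (least (P? ∘ suc) b)

least-spec : ∀ {ℓ} {P : Pred ℕ ℓ} (P? : Decidable P) {m} b →
             P m → m ≤ b → P (least P? b) × least P? b ≤ m
least-spec P? zero pm z≤n = pm , z≤n
least-spec P? (suc b) pm m≤b with P? zero
... | yes p₀ = p₀ , z≤n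
least-spec P? {zero}  (suc b) pm m≤b       | no ¬p₀ = contradiction pm ¬p₀
least-spec P? {suc m} (suc b) pm (s≤s m≤b) | no ¬p₀ =
  Product.map id s≤s (least-spec (P? ∘ suc) b pm m≤b)

module _ {n} {P : Pred (Fin n) 0ℓ} (P? : Decidable P) where

  toSubset : Subset n
  toSubset = tabulateᵥ (does ∘ P?)

  ∈-toSubset⁺ : ∀ {x} → P x → x ∈ₛ toSubset
  ∈-toSubset⁺ {x} px = lookup⇒[]= x toSubset (trans (lookup∘tabulate _ x) (dec-true (P? x) px))

  ∈-toSubset⁻ : ∀ {x} → x ∈ₛ toSubset → P x
  ∈-toSubset⁻ {x} x∈ with P? x | trans (sym (lookup∘tabulate (does ∘ P?) x)) ([]=⇒lookup x∈)
  ... | yes px | _ = px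

module _ {n} {P : ℕ → Pred (Fin n) 0ℓ} (P? : ∀ m → Decidable (P m))
         (increasing : ∀ m → P m ⊆ P (suc m)) where

  private
    -- Each strict step of the chain increases the cardinality.
    stalls-or-grows : ∀ m → (∃ λ j → j < m × P (suc j) ⊆ P j) ⊎ m ≤ ∣ toSubset (P? m) ∣
    stalls-or-grows zero = inj₂ z≤n
    stalls-or-grows (suc m) with stalls-or-grows m
    ... | inj₁ (j , j<m , stall) = inj₁ (j , m<n⇒m<1+n j<m , stall)
    ... | inj₂ m≤∣Pm∣ with any? (λ x → P? (suc m) x ×-dec ¬? (P? m x))
    ...   | yes (x , new , ¬old) = inj₂ (≤-trans (s≤s m≤∣Pm∣) (p⊂q⇒∣p∣<∣q∣ Pm⊂Psm))
      where
      Pm⊂Psm : toSubset (P? m) ⊂ toSubset (P? (suc m))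
      Pm⊂Psm = ∈-toSubset⁺ (P? (suc m)) ∘ increasing m ∘ ∈-toSubset⁻ (P? m)
             , x , ∈-toSubset⁺ (P? (suc m)) new , ¬old ∘ ∈-toSubset⁻ (P? m)
    ...   | no none = inj₁ (m , ≤-refl , λ {x} p → decidable-stable (P? m x) (λ ¬p → none (x , p , ¬p)))

  chain-stalls : ∃ λ j → j ≤ n × P (suc j) ⊆ P j
  chain-stalls with stalls-or-grows (suc n)
  ... | inj₁ (j , j<1+n , stall) = j , ≤-pred j<1+n , stall
  ... | inj₂ 1+n≤∣P∣ = contradiction (≤-trans 1+n≤∣P∣ (∣p∣≤n (toSubset (P? (suc n))))) 1+n≰n

module Layers {n} (G : Graph (Fin n)) {T : Pred (Fin n) 0ℓ} (T? : Decidable T) where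

  Near : ℕ → Pred (Fin n) 0ℓ
  Near zero      = T
  Near (suc m) u = Near m u ⊎ ∃ λ w → E G u w × Near m w

  Adjacent : ℕ → Pred (Fin n) 0ℓ
  Adjacent m u = ∃ λ w → E G u w × Near m w

  near? : ∀ m → Decidable (Near m)
  adjacent? : ∀ m → Decidable (Adjacent m)
  near? zero      = T?
  near? (suc m) u = near? m u ⊎-dec adjacent? m u
  adjacent? m u = any? λ w → E? G u w ×-dec near? m w

  Near-mono : ∀ {m m′} → m ≤′ m′ → Near m ⊆ Near m′
  Near-mono ≤′-refl       = id
  Near-mono (≤′-step m≤′) = inj₁ ∘ Near-mono m≤′

  walk⇒Near : ∀ {u y m} → Walk G u y m → T y → Near m u
  walk⇒Near nil        ty = ty
  walk⇒Near (cons e W) ty = inj₂ (_ , e , walk⇒Near W ty)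

  stall⇒Near-stable : ∀ {j} → Near (suc j) ⊆ Near j → ∀ m → Near m ⊆ Near j
  stall⇒Near-stable stall zero = Near-mono (≤⇒≤′ z≤n)
  stall⇒Near-stable stall (suc m) (inj₁ p)           = stall⇒Near-stable stall m p
  stall⇒Near-stable stall (suc m) (inj₂ (w , e , p)) = stall (inj₂ (w , e , stall⇒Near-stable stall m p))

  Near-saturates : ∀ m → Near m ⊆ Near n
  Near-saturates m with chain-stalls near? (λ _ → inj₁)
  ... | j , j≤n , stall = Near-mono (≤⇒≤′ j≤n) ∘ stall⇒Near-stable stall m

  firstAdjacentLayer : Fin n → ℕ
  firstAdjacentLayer u = least (λ m → adjacent? m u) n

  -- Beyond layer n nothing new appears, so the search up to n suffices.
  firstAdjacentLayer-minimal : ∀ {m u} → Adjacent m u →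
    Adjacent (firstAdjacentLayer u) u × firstAdjacentLayer u ≤ m
  firstAdjacentLayer-minimal {m} {u} adj with m ≤? n
  ... | yes m≤n = least-spec (λ m → adjacent? m u) n adj m≤n
  ... | no  m≰n with adj
  ...   | w , e , p = Product.map id (λ ≤n → ≤-trans ≤n (<⇒≤ (≰⇒> m≰n)))
                        (least-spec (λ m → adjacent? m u) n (w , e , Near-saturates m p) ≤-refl)

  toward : Fin n → Fin n
  toward u with adjacent? (firstAdjacentLayer u) u
  ... | yes (w , _) = w
  ... | no  _       = u

  toward-spec : ∀ {m u} → Adjacent m u → E G u (toward u) × Near m (toward u)
  toward-spec {u = u} adj with firstAdjacentLayer-minimal adj
  ... | first-adj , first≤m with adjacent? (firstAdjacentLayer u) u
  ...   | yes (w , e , p) = e , Near-mono (≤⇒≤′ first≤m) p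
  ...   | no  ¬adj        = contradiction first-adj ¬adj

  Near⇒Reach : (H : PartialOrientation G) →
               (∀ u → E G u (toward u) → arc H u (toward u)) →
               ∀ {m u} → Near m u → ∃ λ y → Reach H u m y × T y
  Near⇒Reach H toward-arc {zero}  {u} tu = u , here , tu
  Near⇒Reach H toward-arc {suc _} (inj₁ p) =
    Product.map id (Product.map Reach-suc id) (Near⇒Reach H toward-arc p)
  Near⇒Reach H toward-arc {suc _} (inj₂ adj) with Near⇒Reach H toward-arc (proj₂ (toward-spec adj))
  ... | y , r , ty = y , step (toward-arc _ (proj₁ (toward-spec adj))) r , ty

Guided : ∀ {V} {G : Graph V} → PartialOrientation G → V → V → ℕ → Set
Guided {V} {G} H u v ℓ = Σ ℕ λ a → Σ ℕ λ b → suc (a + b) ≡ ℓ ×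
  Σ V λ x → Σ V λ y → Reach H u a x × Reach H v b y × E G x y

module _ {V : Set} (G : Graph V) (A : V → Bool) where

  Side : (b : Bool) → Graph (Σ V λ v → A v ≡ b)
  Side b = induced G λ v → A v ≡ b

  record Crossing (u v : V) (ℓ : ℕ) : Set where
    constructor crossing
    field
      {i j}  : ℕ
      {x y}  : V
      prefix : Walk G u x i
      edge   : E G x y
      sides  : A x ≢ A y
      suffix : Walk G y v j
      len    : suc (i + j) ≡ ℓ

  walk-inside-or-crossing : ∀ b {u v ℓ} (p : A u ≡ b) → Walk G u v ℓ →
    (Σ (A v ≡ b) λ q → Walk (Side b) (u , p) (v , q) ℓ) ⊎ Crossing u v ℓ
  walk-inside-or-crossing b p nil = inj₁ (p , nil)
  walk-inside-or-crossing b p (cons {x = x} e W) with A x ≟ᴮ b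
  ... | no Ax≢b = inj₂ (crossing nil e (λ Au≡Ax → Ax≢b (trans (sym Au≡Ax) p)) W refl)
  ... | yes Ax≡b with walk-inside-or-crossing b Ax≡b W
  ...   | inj₁ (q , W′) = inj₁ (q , cons e W′)
  ...   | inj₂ (crossing W₁ e′ sides W₂ len) = inj₂ (crossing (cons e W₁) e′ sides W₂ (cong suc len))

  EquivAB-cross-edge : ∀ {x y w z} → E G x y → A x ≢ A y →
    EquivAB G A x w → EquivAB G A y z → E G w z
  EquivAB-cross-edge e Ax≢Ay (inj₁ (Ax , _ , _)) (inj₁ (Ay , _ , _)) = contradiction (trans Ax (sym Ay)) Ax≢Ay
  EquivAB-cross-edge e Ax≢Ay (inj₂ (Ax , _ , _)) (inj₂ (Ay , _ , _)) = contradiction (trans Ax (sym Ay)) Ax≢Ay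
  EquivAB-cross-edge {y = y} {w} e _ (inj₁ (_ , Aw , x≈w)) (inj₂ (Ay , _ , y≈z)) =
    Graph.sym G (proj₁ (y≈z w Aw) (Graph.sym G (proj₁ (x≈w y Ay) e)))
  EquivAB-cross-edge {y = y} {w} e _ (inj₂ (_ , Aw , x≈w)) (inj₁ (Ay , _ , y≈z)) =
    Graph.sym G (proj₁ (y≈z w Aw) (Graph.sym G (proj₁ (x≈w y Ay) e)))

module Combine {n} (G : Graph (Fin n)) (A : Fin n → Bool) {k c} (class : Fin n → Fin k)
  (class-≡ : ∀ {u v} → class u ≡ class v → EquivAB G A u v)
  (HS : ∀ b → PartialOrientation (Side G A b)) (maxdeg : ∀ b → MaxOutDeg≤ (HS b) c) where

  module L (i : Fin k) = Layers G (λ y → class y ≟ i)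

  data Arc (u w : Fin n) : Set where
    side   : ∀ b (p : A u ≡ b) (q : A w ≡ b) → arc (HS b) (u , p) (w , q) → Arc u w
    toward : ∀ i → w ≡ L.toward i u → E G u w → Arc u w

  H : PartialOrientation G
  H = record { arc = Arc ; arc⊆E = Arc⊆E }
    where
    Arc⊆E : ∀ {u w} → Arc u w → E G u w
    Arc⊆E (side b _ _ a) = arc⊆E (HS b) a
    Arc⊆E (toward _ _ e) = e

  H-maxOutDeg : MaxOutDeg≤ H (c + k)
  H-maxOutDeg u = sideOut ++ tabulate (λ i → L.toward i u) , length≤ , ∈out
    where
    sideOut : List (Fin n)
    sideOut = map proj₁ (proj₁ (maxdeg (A u) (u , refl)))

    length≤ : length (sideOut ++ tabulate (λ i → L.toward i u)) ≤ c + k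
    length≤ rewrite length-++ sideOut {tabulate (λ i → L.toward i u)}
                  | length-map proj₁ (proj₁ (maxdeg (A u) (u , refl)))
                  | length-tabulate (λ i → L.toward i u)
      = +-mono-≤ (proj₁ (proj₂ (maxdeg (A u) (u , refl)))) ≤-refl

    ∈sideOut : ∀ {w} b (p : A u ≡ b) q → arc (HS b) (u , p) (w , q) → w ∈ sideOut
    ∈sideOut {w} _ refl q a = ∈-map⁺ proj₁ (proj₂ (proj₂ (maxdeg (A u) (u , refl))) (w , q) a)

    ∈out : ∀ w → Arc u w → w ∈ sideOut ++ tabulate (λ i → L.toward i u)
    ∈out w (side b p q a)    = ∈-++⁺ˡ (∈sideOut b p q a)
    ∈out w (toward i refl _) = ∈-++⁺ʳ sideOut (∈-tabulate⁺ i)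

  reach-class : ∀ {u x m} → Walk G u x m → ∃ λ y → Reach H u m y × class y ≡ class x
  reach-class {x = x} W =
    L.Near⇒Reach (class x) H (λ _ → toward (class x) refl) (L.walk⇒Near (class x) W refl)

  crossing⇒Guided : ∀ {u v ℓ} → Crossing G A u v ℓ → Guided H u v ℓ
  crossing⇒Guided (crossing W₁ e sides W₂ len) with reach-class W₁ | reach-class (Walk-reverse W₂)
  ... | w , rw , cw | z , rz , cz =
    _ , _ , len , w , z , rw , rz , EquivAB-cross-edge G A e sides (class-≡ (sym cw)) (class-≡ (sym cz))

  H-guidance : ∀ r → (∀ b → WeakGuidanceℕ (Side G A b) r (HS b)) → WeakGuidanceℕ G r H
  H-guidance r guidance u v u≢v ℓ ℓ≤r (W , shortest) with walk-inside-or-crossing G A (A u) refl W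
  ... | inj₂ cr = crossing⇒Guided cr
  ... | inj₁ (q , W′) with guidance (A u) (u , refl) (v , q) (u≢v ∘ cong proj₁) ℓ ℓ≤r
                             (W′ , λ m → shortest m ∘ Walk-map proj₁ id)
  ...   | a , b , len , x , y , rx , ry , e =
    a , b , len , proj₁ x , proj₁ y , Reach-map proj₁ side↦ rx , Reach-map proj₁ side↦ ry , e
    where
    side↦ : ∀ {s t} → arc (HS (A u)) s t → Arc (proj₁ s) (proj₁ t)
    side↦ {s} {t} = side (A u) (proj₂ s) (proj₂ t)

lemma33 : (n : ℕ) (G : Graph (Fin n)) (A : Fin n → Bool) (r : Radius) → PositiveRadius r →
    (k c : ℕ) → HasClasses (EquivAB G A) k →
    (HA : PartialOrientation (induced G (λ v → A v ≡ true))) →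
    WeakGuidance (induced G (λ v → A v ≡ true)) r HA → MaxOutDeg≤ HA c →
    (HB : PartialOrientation (induced G (λ v → A v ≡ false))) →
    WeakGuidance (induced G (λ v → A v ≡ false)) r HB → MaxOutDeg≤ HB c →
    Σ (PartialOrientation G) λ H → WeakGuidance G r H × MaxOutDeg≤ H (c + k)
lemma33 n G A r _ k c (class , _ , class-spec) HA guidanceA maxdegA HB guidanceB maxdegB =
  C.H , guidance r guidanceA guidanceB , C.H-maxOutDeg
  where
  HS : ∀ b → PartialOrientation (Side G A b)
  HS true  = HA
  HS false = HB

  maxdeg : ∀ b → MaxOutDeg≤ (HS b) c
  maxdeg true  = maxdegA
  maxdeg false = maxdegB

  module C = Combine G A class (λ {u} {v} → proj₂ (class-spec u v)) HS maxdeg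

  guidance : ∀ r → WeakGuidance (Side G A true) r HA → WeakGuidance (Side G A false) r HB →
             WeakGuidance G r C.H
  guidance (fin r) gA gB = C.H-guidance r λ { true → gA ; false → gB }
  guidance ∞       gA gB = λ r r≥1 → C.H-guidance r λ { true → gA r r≥1 ; false → gB r r≥1 }
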